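{- Let $n \geq 13$ and $p \geq 4$. In the $p$-player Zeckendorf game on $n$, no player has a winning strategy.
   Context: Let $F_1=1$, $F_2=2$, $F_{i+1}=F_i+F_{i-1}$. The Zeckendorf game on $n$ starts with the multiset of $n$ copies of $1$. A move is one of: if the list contains $F_{i-1}$ and $F_i$, replace them by $F_{i+1}$; if the list contains two copies of $F_i$: for $i=1$ replace them by $F_2$; for $i=2$ replace them by $F_1,F_3$; for $i\geq 3$ replace them by $F_{i-2},F_{i+1}$. The game ends when the list is the Zeckendorf decomposition of $n$ (distinct, pairwise non-consecutive Fibonacci numbers); every game terminates. In the $p$-player game, players $1,\dots,p$ move in cyclic order $1,2,\dots,p,1,2,\dots$ starting with player 1; the player making the final move wins. A player has a winning strategy if he can choose his moves so that he makes the final move no matter what moves the other players make. -}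

module Defs where

open import Data.Nat using (ℕ; zero; suc; _+_; _*_; _≤_; _≡ᵇ_)
open import Data.Bool using (if_then_else_)
open import Data.Product using (_×_)
open import Data.Sum using (_⊎_)
open import Relation.Nullary using (¬_)
open import Relation.Binary.PropositionalEquality using (_≡_; _≢_)

-- Fibonacci numbers of the paper: F₁ = 1, F₂ = 2, F_{i+1} = F_i + F_{i-1}.
-- (Recorded for reference; the game is encoded on indices.)
-- fib k = F_{k+1}
fib : ℕ → ℕ
fib zero = 1
fib (suc zero) = 2
fib (suc (suc k)) = fib (suc k) + fib k

-- A game state is a multiset of Fibonacci numbers, encoded by its
-- multiplicity function:  s j = number of copies of F_{j+1} = fib j.
State : Set
State = ℕ → ℕ

δ : ℕ → ℕ → ℕ
δ a j = if a ≡ᵇ j then 1 else 0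

start : ℕ → State
start n zero = n
start n (suc j) = 0

data Move (s s' : State) : Set where
  -- F_{i-1}, F_i ↦ F_{i+1}   (i ≥ 2; a = index of F_{i-1})
  add    : (a : ℕ) → 1 ≤ s a → 1 ≤ s (suc a) →
           (∀ j → s' j + δ a j + δ (suc a) j ≡ s j + δ (suc (suc a)) j) →
           Move s s'
  -- F₁, F₁ ↦ F₂
  split1 : 2 ≤ s 0 →
           (∀ j → s' j + 2 * δ 0 j ≡ s j + δ 1 j) →
           Move s s'
  -- F₂, F₂ ↦ F₁, F₃
  split2 : 2 ≤ s 1 →
           (∀ j → s' j + 2 * δ 1 j ≡ s j + δ 0 j + δ 2 j) →
           Move s s'
  -- F_i, F_i ↦ F_{i-2}, F_{i+1}   (i ≥ 3; a = index of F_{i-2}, so F_i has index a+2)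
  split  : (a : ℕ) → 2 ≤ s (suc (suc a)) →
           (∀ j → s' j + 2 * δ (suc (suc a)) j ≡ s j + δ a j + δ (suc (suc (suc a))) j) →
           Move s s'

Zeck : State → Set
Zeck s = (∀ j → s j ≤ 1) × (∀ j → s j ≡ 0 ⊎ s (suc j) ≡ 0)

-- Players are 0,1,…,p-1 (player 0 of Agda = player 1 of the paper),
-- moving cyclically.
next : ℕ → ℕ → ℕ
next p t = if suc t ≡ᵇ p then 0 else suc t

-- Wins p k t s : in the p-player game, from state s with player t to move,
-- player k has a winning strategy (can guarantee to make the final move,
-- i.e. the move producing the Zeckendorf decomposition).
data Wins (p k : ℕ) : ℕ → State → Set where
  final : ∀ {t s s'} → t ≡ k → ¬ Zeck s → Move s s' → Zeck s' → Wins p k t s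
  mine  : ∀ {t s s'} → t ≡ k → ¬ Zeck s → Move s s' → Wins p k (next p t) s' →
          Wins p k t s
  other : ∀ {t s} → t ≢ k → ¬ Zeck s →
          (∀ s' → Move s s' → Wins p k (next p t) s') → Wins p k t s

-- Uniqueness: from a given position and turn at most one player can force the final
-- move (both strategies are followed along a common play until one of the claimed
-- winners moves).  A position with F₁,F₁,F₂ reaches the same position F₁,F₃ in one move
-- (F₁+F₂) and in two moves (F₁F₁ ↦ F₂, then F₂F₂ ↦ F₁F₃).  If player k wins and the
-- opponents make these moves, then k wins from that position both on turn t+1 and on
-- turn t+2; rotating the first strategy, player k+1 also wins on turn t+2, contradicting
-- uniqueness.  With p ≥ 4, before three consecutive opponent turns occur k moves at most
-- three times, each move removing at most two F₁, so n ≥ 13 leaves enough F₁ to start.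
module Submission where

open import Defs
open import Data.Nat using (ℕ; zero; suc; _+_; _*_; _∸_; _≡ᵇ_; _≤_; _<_; z≤n; s≤s; _≤?_; _<?_)
open import Data.Nat.Properties
open import Data.Nat.GeneralisedArithmetic using (iterate)
open import Data.Bool using (true; false; T)
open import Data.Unit using (tt)
open import Data.Fin using (toℕ; fromℕ<)
open import Data.Fin.Properties using (any?; toℕ-fromℕ<)
open import Data.Product using (∃; ∃₂; _×_; _,_; proj₁)
open import Data.Sum using (_⊎_; inj₁; inj₂)
open import Function using (_∘′_)
open import Relation.Nullary using (¬_; Dec; yes; no; _⊎-dec_; _×-dec_; contradiction)
open import Relation.Binary.PropositionalEquality

δ-self : ∀ x → δ x x ≡ 1
δ-self zero = refl
δ-self (suc x) = δ-self x

δ-≢ : ∀ {x j} → x ≢ j → δ x j ≡ 0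
δ-≢ {zero} {zero} x≢j = contradiction refl x≢j
δ-≢ {zero} {suc j} _ = refl
δ-≢ {suc x} {zero} _ = refl
δ-≢ {suc x} {suc j} x≢j = δ-≢ (x≢j ∘′ cong suc)

δ≤1 : ∀ x j → δ x j ≤ 1
δ≤1 zero zero = ≤-refl
δ≤1 zero (suc j) = z≤n
δ≤1 (suc x) zero = z≤n
δ≤1 (suc x) (suc j) = δ≤1 x j

+δ-≢ : ∀ n {x j} → x ≢ j → n + δ x j ≡ n
+δ-≢ n x≢j = trans (cong (n +_) (δ-≢ x≢j)) (+-identityʳ n)

*δ≤ : ∀ {s : State} {x} c → c ≤ s x → ∀ j → c * δ x j ≤ s j
*δ≤ {x = x} c c≤sx j with x ≟ j
... | yes refl rewrite δ-self x | *-identityʳ c = c≤sx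
... | no x≢j rewrite δ-≢ x≢j | *-zeroʳ c = z≤n

next-spec : ∀ p t → (suc t ≡ p × next p t ≡ 0) ⊎ next p t ≡ suc t
next-spec p t with suc t ≡ᵇ p in eq
... | true = inj₁ (≡ᵇ⇒≡ (suc t) p (subst T (sym eq) tt) , refl)
... | false = inj₂ refl

next-injective : ∀ p {t u} → next p t ≡ next p u → t ≡ u
next-injective p {t} {u} e with next-spec p t | next-spec p u
... | inj₁ (t+1≡p , _) | inj₁ (u+1≡p , _) = suc-injective (trans t+1≡p (sym u+1≡p))
... | inj₁ (_ , nt≡0) | inj₂ nu≡u+1 = contradiction (trans (sym nt≡0) (trans e nu≡u+1)) λ ()
... | inj₂ nt≡t+1 | inj₁ (_ , nu≡0) = contradiction (trans (sym nu≡0) (trans (sym e) nt≡t+1)) λ ()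
... | inj₂ nt≡t+1 | inj₂ nu≡u+1 = suc-injective (trans (sym nt≡t+1) (trans e nu≡u+1))

next-≢-self : ∀ {p} → 2 ≤ p → ∀ t → next p t ≢ t
next-≢-self {p} 2≤p t e with next-spec p t
... | inj₁ (t+1≡p , nt≡0) with trans (sym nt≡0) e
...   | refl = contradiction (subst (2 ≤_) (sym t+1≡p) 2≤p) λ { (s≤s ()) }
next-≢-self 2≤p t e | inj₂ nt≡t+1 = 1+n≢n (trans (sym nt≡t+1) e)

next≤suc : ∀ p t → next p t ≤ suc t
next≤suc p t with next-spec p t
... | inj₁ (_ , nt≡0) rewrite nt≡0 = z≤n
... | inj₂ nt≡t+1 rewrite nt≡t+1 = ≤-refl

next-≢-≤ : ∀ {p t j} → 1 ≤ j → j ≤ t → next p t ≢ j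
next-≢-≤ {p} {t} 1≤j j≤t e with next-spec p t
... | inj₁ (_ , nt≡0) = contradiction (trans (sym e) nt≡0) (≢-sym (<⇒≢ 1≤j))
... | inj₂ nt≡t+1 = <⇒≢ (s≤s j≤t) (trans (sym e) nt≡t+1)

next²-≢ : ∀ {p t j} → 2 ≤ j → j ≤ suc t → next p (next p t) ≢ j
next²-≢ {p} {t} 2≤j j≤t+1 with next-spec p t
... | inj₁ (_ , nt≡0) rewrite nt≡0 = <⇒≢ (≤-trans (s≤s (next≤suc p 0)) 2≤j)
... | inj₂ nt≡t+1 rewrite nt≡t+1 = next-≢-≤ {p} (≤-trans (s≤s z≤n) 2≤j) j≤t+1

Wins⇒¬Zeck : ∀ {p k t s} → Wins p k t s → ¬ Zeck s
Wins⇒¬Zeck (final _ ¬z _ _) = ¬z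
Wins⇒¬Zeck (mine _ ¬z _ _) = ¬z
Wins⇒¬Zeck (other _ ¬z _) = ¬z

Wins-opponent : ∀ {p k t s s'} → t ≢ k → Wins p k t s → Move s s' → Wins p k (next p t) s'
Wins-opponent t≢k (final t≡k _ _ _) _ = contradiction t≡k t≢k
Wins-opponent t≢k (mine t≡k _ _ _) _ = contradiction t≡k t≢k
Wins-opponent _ (other _ _ win) m = win _ m

Wins-next : ∀ {p k t s} → Wins p k t s → Wins p (next p k) (next p t) s
Wins-next {p} (final t≡k ¬z m z) = final (cong (next p) t≡k) ¬z m z
Wins-next {p} (mine t≡k ¬z m w) = mine (cong (next p) t≡k) ¬z m (Wins-next w)
Wins-next {p} (other t≢k ¬z win) =
  other (t≢k ∘′ next-injective p) ¬z (λ s' m → Wins-next (win s' m))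

FinSupp : State → Set
FinSupp s = ∃ λ B → ∀ j → B ≤ j → s j ≡ 0

start-FinSupp : ∀ n → FinSupp (start n)
start-FinSupp n = 1 , λ { zero () ; (suc j) _ → refl }

positive⇒below : ∀ {s : State} {B} → (∀ j → B ≤ j → s j ≡ 0) → ∀ {i} → 1 ≤ s i → i < B
positive⇒below {s} vanish {i} 1≤si = ≰⇒> λ B≤i → contradiction (subst (1 ≤_) (vanish i B≤i) 1≤si) λ ()

Move-support : ∀ {s s'} → Move s s' → ∃ λ i → 1 ≤ s i × (∀ j → suc i < j → s' j ≤ s j)
Move-support {s} {s'} (add a _ 1≤s[a+1] e) = suc a , 1≤s[a+1] , λ j a+2<j →
  m+n≤o⇒m≤o (s' j) (m+n≤o⇒m≤o (s' j + δ a j)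
    (≤-reflexive (trans (e j) (+δ-≢ (s j) (<⇒≢ a+2<j)))))
Move-support {s} {s'} (split1 2≤s0 e) = 0 , ≤-trans (s≤s z≤n) 2≤s0 , λ j 1<j →
  m+n≤o⇒m≤o (s' j) (≤-reflexive (trans (e j) (+δ-≢ (s j) (<⇒≢ 1<j))))
Move-support {s} {s'} (split2 2≤s1 e) = 1 , ≤-trans (s≤s z≤n) 2≤s1 , λ j 2<j →
  m+n≤o⇒m≤o (s' j) (≤-reflexive (trans (e j)
    (trans (+δ-≢ (s j + δ 0 j) (<⇒≢ 2<j)) (+δ-≢ (s j) (<⇒≢ (≤-trans (s≤s z≤n) 2<j))))))
Move-support {s} {s'} (split a 2≤s[a+2] e) = suc (suc a) , ≤-trans (s≤s z≤n) 2≤s[a+2] , λ j a+3<j →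
  m+n≤o⇒m≤o (s' j) (≤-reflexive (trans (e j)
    (trans (+δ-≢ (s j + δ a j) (<⇒≢ a+3<j)) (+δ-≢ (s j) (<⇒≢ (≤-trans (m≤n+m (suc a) 3) a+3<j))))))

FinSupp-Move : ∀ {s s'} → Move s s' → FinSupp s → FinSupp s'
FinSupp-Move {s} {s'} m (B , vanish) with Move-support m
... | i , 1≤si , s'≤s = suc B , λ j B<j →
  n≤0⇒n≡0 (subst (s' j ≤_) (vanish j (≤-trans (n≤1+n B) B<j)) (s'≤s j (≤-trans (s≤s (positive⇒below vanish 1≤si)) B<j)))

Move-ones : ∀ {s s'} → Move s s' → s 0 ≤ 2 + s' 0
Move-ones {s} {s'} m = subst (s 0 ≤_) (+-comm (s' 0) 2) (from-equation m)
  where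
  from-equation : Move s s' → s 0 ≤ s' 0 + 2
  from-equation (add a _ _ e) = begin
    s 0                 ≤⟨ m≤m+n (s 0) 0 ⟩
    s 0 + 0             ≡⟨ sym (e 0) ⟩
    s' 0 + δ a 0 + 0    ≤⟨ +-monoˡ-≤ 0 (+-monoʳ-≤ (s' 0) (≤-trans (δ≤1 a 0) (n≤1+n 1))) ⟩
    s' 0 + 2 + 0        ≡⟨ +-identityʳ _ ⟩
    s' 0 + 2            ∎
    where open ≤-Reasoning
  from-equation (split1 _ e) = m+n≤o⇒m≤o (s 0) (≤-reflexive (sym (e 0)))
  from-equation (split2 _ e) =
    ≤-trans (m+n≤o⇒m≤o (s 0) (m+n≤o⇒m≤o (s 0 + 1) (≤-reflexive (sym (e 0))))) (+-monoʳ-≤ (s' 0) z≤n)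
  from-equation (split a _ e) =
    ≤-trans (m+n≤o⇒m≤o (s 0) (m+n≤o⇒m≤o (s 0 + δ a 0) (≤-reflexive (sym (e 0))))) (+-monoʳ-≤ (s' 0) z≤n)

rebalance : (s g r : State) → (∀ i → r i ≤ s i) → ∃ λ s' → ∀ i → s' i + r i ≡ s i + g i
rebalance s g r r≤s = (λ i → s i + g i ∸ r i) , λ i → m∸n+n≡m (≤-trans (r≤s i) (m≤m+n (s i) (g i)))

Move-add : ∀ {s} a → 1 ≤ s a → 1 ≤ s (suc a) → ∃ (Move s)
Move-add {s} a 1≤sa 1≤s[a+1] with rebalance s (δ (suc (suc a))) (λ j → δ a j + δ (suc a) j) removable
  where
  removable : ∀ j → δ a j + δ (suc a) j ≤ s j
  removable j with a ≟ j
  ... | yes refl rewrite δ-self a | δ-≢ (1+n≢n {a}) = 1≤sa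
  ... | no a≢j rewrite δ-≢ a≢j = subst (_≤ s j) (*-identityˡ _) (*δ≤ {s} {suc a} 1 1≤s[a+1] j)
... | s' , e = s' , add a 1≤sa 1≤s[a+1] λ j → trans (+-assoc (s' j) _ _) (e j)

mergeOnes : State → State
mergeOnes s zero = s 0 ∸ 2
mergeOnes s (suc zero) = s 1 + 1
mergeOnes s (suc (suc j)) = s (suc (suc j))

Move-mergeOnes : ∀ {s} → 2 ≤ s 0 → Move s (mergeOnes s)
Move-mergeOnes {s} 2≤s0 = split1 2≤s0 e
  where
  e : ∀ j → mergeOnes s j + 2 * δ 0 j ≡ s j + δ 1 j
  e zero = trans (m∸n+n≡m 2≤s0) (sym (+-identityʳ (s 0)))
  e (suc zero) = +-identityʳ (s 1 + 1)
  e (suc (suc j)) = refl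

Move-split2 : ∀ {s} → 2 ≤ s 1 → ∃ (Move s)
Move-split2 {s} 2≤s1 with rebalance s (λ j → δ 0 j + δ 2 j) (λ j → 2 * δ 1 j) (*δ≤ {s} 2 2≤s1)
... | s' , e = s' , split2 2≤s1 λ j → trans (e j) (sym (+-assoc (s j) _ _))

Move-split : ∀ {s} a → 2 ≤ s (suc (suc a)) → ∃ (Move s)
Move-split {s} a 2≤s[a+2]
  with rebalance s (λ j → δ a j + δ (suc (suc (suc a))) j) (λ j → 2 * δ (suc (suc a)) j) (*δ≤ {s} 2 2≤s[a+2])
... | s' , e = s' , split a 2≤s[a+2] λ j → trans (e j) (sym (+-assoc (s j) _ _))

Reducible : State → ℕ → Set
Reducible s j = 2 ≤ s j ⊎ (1 ≤ s j × 1 ≤ s (suc j))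

Reducible? : ∀ s j → Dec (Reducible s j)
Reducible? s j = (2 ≤? s j) ⊎-dec ((1 ≤? s j) ×-dec (1 ≤? s (suc j)))

Reducible⇒Move : ∀ {s j} → Reducible s j → ∃ (Move s)
Reducible⇒Move {j = j} (inj₂ (1≤sj , 1≤s[j+1])) = Move-add j 1≤sj 1≤s[j+1]
Reducible⇒Move {j = zero} (inj₁ 2≤s0) = _ , Move-mergeOnes 2≤s0
Reducible⇒Move {j = suc zero} (inj₁ 2≤s1) = Move-split2 2≤s1
Reducible⇒Move {j = suc (suc a)} (inj₁ 2≤s[a+2]) = Move-split a 2≤s[a+2]

Reducible⇒positive : ∀ {s j} → Reducible s j → 1 ≤ s j
Reducible⇒positive (inj₁ 2≤sj) = ≤-trans (s≤s z≤n) 2≤sj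
Reducible⇒positive (inj₂ (1≤sj , _)) = 1≤sj

Zeck-if-irreducible : ∀ {s} → (∀ j → ¬ Reducible s j) → Zeck s
Zeck-if-irreducible {s} good = (λ j → ≮⇒≥ (good j ∘′ inj₁)) , isolated
  where
  isolated : ∀ j → s j ≡ 0 ⊎ s (suc j) ≡ 0
  isolated j with s j in sj
  ... | zero = inj₁ refl
  ... | suc _ = inj₂ (n≤0⇒n≡0 (≮⇒≥ λ 1≤s[j+1] → good j (inj₂ (subst (1 ≤_) (sym sj) (s≤s z≤n) , 1≤s[j+1]))))

¬Zeck⇒Move : ∀ {s} → FinSupp s → ¬ Zeck s → ∃ (Move s)
¬Zeck⇒Move {s} (B , vanish) ¬z with any? {n = B} (λ i → Reducible? s (toℕ i))
... | yes (i , bad) = Reducible⇒Move bad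
... | no none = contradiction (Zeck-if-irreducible good) ¬z
  where
  good : ∀ j → ¬ Reducible s j
  good j bad with j <? B
  ... | yes j<B = none (fromℕ< j<B , subst (Reducible s) (sym (toℕ-fromℕ< j<B)) bad)
  ... | no j≮B = contradiction (subst (1 ≤_) (vanish j (≮⇒≥ j≮B)) (Reducible⇒positive {s} bad)) λ ()

Wins-unique : ∀ {p k k' t s} → FinSupp s → Wins p k t s → Wins p k' t s → k ≡ k'
Wins-unique _ (final t≡k _ _ _) (final t≡k' _ _ _) = trans (sym t≡k) t≡k'
Wins-unique _ (final t≡k _ _ _) (mine t≡k' _ _ _) = trans (sym t≡k) t≡k'
Wins-unique _ (mine t≡k _ _ _) (final t≡k' _ _ _) = trans (sym t≡k) t≡k'
Wins-unique _ (mine t≡k _ _ _) (mine t≡k' _ _ _) = trans (sym t≡k) t≡k'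
Wins-unique _ (final _ _ m z) (other _ _ win) = contradiction z (Wins⇒¬Zeck (win _ m))
Wins-unique _ (other _ _ win) (final _ _ m z) = contradiction z (Wins⇒¬Zeck (win _ m))
Wins-unique fs (mine _ _ m w) (other _ _ win) = Wins-unique (FinSupp-Move m fs) w (win _ m)
Wins-unique fs (other _ _ win) (mine _ _ m w) = Wins-unique (FinSupp-Move m fs) (win _ m) w
Wins-unique fs (other _ ¬z win) (other _ _ win') with ¬Zeck⇒Move fs ¬z
... | s' , m = Wins-unique (FinSupp-Move m fs) (win s' m) (win' s' m)

Wins-advance : ∀ {p k t s} → 4 ≤ s 0 → FinSupp s → Wins p k t s →
  ∃ λ s' → Move s s' × Wins p k (next p t) s'
Wins-advance 4≤s0 _ (final _ _ m z) =
  contradiction (≤-trans 4≤s0 (≤-trans (Move-ones m) (+-monoʳ-≤ 2 (proj₁ z 0)))) (1+n≰n {3})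
Wins-advance _ _ (mine _ _ m w) = _ , m , w
Wins-advance _ fs (other _ ¬z win) with ¬Zeck⇒Move fs ¬z
... | s' , m = s' , m , win s' m

Move-shortcut : ∀ {s} → 2 ≤ s 0 → 1 ≤ s 1 → ∃₂ λ b c → Move s b × Move b c × Move s c
Move-shortcut {s} 2≤s0 1≤s1 =
  mergeOnes s , c , Move-mergeOnes 2≤s0 , split2 (+-monoˡ-≤ 1 1≤s1) via-b , add 0 (≤-trans (s≤s z≤n) 2≤s0) 1≤s1 direct
  where
  c : State
  c zero = s 0 ∸ 2 + 1
  c (suc zero) = s 1 ∸ 1
  c (suc (suc zero)) = s 2 + 1
  c (suc (suc (suc j))) = s (suc (suc (suc j)))

  via-b : ∀ j → c j + 2 * δ 1 j ≡ mergeOnes s j + δ 0 j + δ 2 j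
  via-b zero = refl
  via-b (suc zero) = begin
    s 1 ∸ 1 + 2           ≡⟨ sym (+-assoc (s 1 ∸ 1) 1 1) ⟩
    s 1 ∸ 1 + 1 + 1       ≡⟨ cong (_+ 1) (m∸n+n≡m 1≤s1) ⟩
    s 1 + 1               ≡⟨ sym (trans (+-identityʳ _) (+-identityʳ _)) ⟩
    s 1 + 1 + 0 + 0       ∎
    where open ≡-Reasoning
  via-b (suc (suc zero)) = trans (+-identityʳ (s 2 + 1)) (cong (_+ 1) (sym (+-identityʳ (s 2))))
  via-b (suc (suc (suc j))) = sym (+-identityʳ _)

  direct : ∀ j → c j + δ 0 j + δ 1 j ≡ s j + δ 2 j
  direct zero = cong (_+ 0) (trans (+-assoc (s 0 ∸ 2) 1 1) (m∸n+n≡m 2≤s0))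
  direct (suc zero) = trans (cong (_+ 1) (+-identityʳ (s 1 ∸ 1))) (trans (m∸n+n≡m 1≤s1) (sym (+-identityʳ (s 1))))
  direct (suc (suc zero)) = trans (+-identityʳ _) (+-identityʳ _)
  direct (suc (suc (suc j))) = +-identityʳ _

¬Wins-two-opponents : ∀ {p k t s} → 2 ≤ p → 2 ≤ s 0 → 1 ≤ s 1 → FinSupp s →
  t ≢ k → next p t ≢ k → ¬ Wins p k t s
¬Wins-two-opponents {p} {k} {t} 2≤p 2≤s0 1≤s1 fs t≢k t+1≢k win with Move-shortcut 2≤s0 1≤s1
... | b , c , s→b , b→c , s→c =
  next-≢-self 2≤p k (sym (Wins-unique (FinSupp-Move s→c fs) long (Wins-next short)))
  where
  short : Wins p k (next p t) c
  short = Wins-opponent t≢k win s→c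
  long : Wins p k (next p (next p t)) c
  long = Wins-opponent t+1≢k (Wins-opponent t≢k win s→b) b→c

¬Wins-three-opponents : ∀ {p k t s} → 2 ≤ p → 4 ≤ s 0 → FinSupp s →
  t ≢ k → next p t ≢ k → next p (next p t) ≢ k → ¬ Wins p k t s
¬Wins-three-opponents {s = s} 2≤p 4≤s0 fs t≢k t+1≢k t+2≢k win =
  ¬Wins-two-opponents 2≤p (∸-monoˡ-≤ 2 4≤s0) (m≤n+m 1 (s 1)) (FinSupp-Move merge fs) t+1≢k t+2≢k
    (Wins-opponent t≢k win merge)
  where
  merge : Move s (mergeOnes s)
  merge = Move-mergeOnes (≤-trans (m≤n+m 2 2) 4≤s0)

¬Wins-after : ∀ {p k s} m t → 2 ≤ p → 4 + 2 * m ≤ s 0 → FinSupp s →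
  let u = iterate (next p) t m in u ≢ k → next p u ≢ k → next p (next p u) ≢ k → ¬ Wins p k t s
¬Wins-after zero t 2≤p 4≤s0 fs = ¬Wins-three-opponents 2≤p 4≤s0 fs
¬Wins-after {p} {s = s} (suc m) t 2≤p bound fs u≢k u+1≢k u+2≢k win
  with Wins-advance (≤-trans (m≤m+n 4 _) bound) fs win
... | s' , step , win' = ¬Wins-after m (next p t) 2≤p bound' (FinSupp-Move step fs) u≢k u+1≢k u+2≢k win'
  where
  bound' : 4 + 2 * m ≤ s' 0
  bound' = ≤-pred (≤-pred (≤-trans (subst (_≤ s 0) (cong (4 +_) (*-suc 2 m)) bound) (Move-ones step)))

lemma2p1p1 : (n p : ℕ) → 13 ≤ n → 4 ≤ p →
    (k : ℕ) → k < p → ¬ Wins p k 0 (start n)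
lemma2p1p1 n p 13≤n 4≤p@(s≤s (s≤s (s≤s (s≤s _)))) k _ = no-winner k
  where
  after : ∀ {k} m → 4 + 2 * m ≤ n → let u = iterate (next p) 0 m in
    u ≢ k → next p u ≢ k → next p (next p u) ≢ k → ¬ Wins p k 0 (start n)
  after m bound = ¬Wins-after m 0 (≤-trans (s≤s (s≤s z≤n)) 4≤p) bound (start-FinSupp n)

  no-winner : ∀ k → ¬ Wins p k 0 (start n)
  no-winner zero = after 1 (≤-trans (m≤m+n _ _) 13≤n) (λ ()) (λ ()) (λ ())
  no-winner (suc zero) = after 2 (≤-trans (m≤m+n _ _) 13≤n)
    (λ ()) (λ ()) (next-≢-≤ {p} (s≤s z≤n) (s≤s z≤n))
  no-winner (suc (suc zero)) = after 3 (≤-trans (m≤m+n _ _) 13≤n)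
    (λ ()) (next-≢-≤ {p} (s≤s z≤n) (s≤s (s≤s z≤n))) (next²-≢ {p} (s≤s (s≤s z≤n)) (s≤s (s≤s z≤n)))
  no-winner (suc (suc (suc _))) = after 0 (≤-trans (m≤m+n _ _) 13≤n) (λ ()) (λ ()) (λ ())
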